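{- Let $G$ be a finite simple graph with $|V(G)|\ge 2$ and density $d(G)\ge \frac23$. Then $G$ has a connected component $G'$ with $|V(G')|>\frac23|V(G)|$, and furthermore \[ \alpha(G')+1\le 2|V(G')|-|V(G)|. \]
   Context: The density of a graph $G=(V,E)$ with $|V|\ge 2$ is $d(G)=|E|/\binom{|V|}{2}$. $\alpha(G')$ denotes the independence number of $G'$, i.e. the size of a largest independent set of vertices in $G'$. -}

module Defs where

open import Data.Nat using (ℕ; zero; suc; _+_; _*_; _≤_)
open import Data.Bool using (Bool; true; false; if_then_else_)
open import Data.Fin using (Fin; _<?_)
open import Data.Fin.Subset using (Subset; _∈_; _⊆_; ∣_∣)
open import Data.List using (List; map; allFin)
open import Data.Nat.ListAction using (sum)
open import Data.Product using (Σ; ∃; _×_; _,_)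
open import Relation.Nullary using (¬_; does)
open import Relation.Binary.PropositionalEquality using (_≡_)

record Graph (n : ℕ) : Set where
  field
    adj     : Fin n → Fin n → Bool
    adj-sym : ∀ u v → adj u v ≡ adj v u
    irrefl  : ∀ v → adj v v ≡ false
open Graph public

Adj : ∀ {n} → Graph n → Fin n → Fin n → Set
Adj G u v = adj G u v ≡ true

edgeCount : ∀ {n} → Graph n → ℕ
edgeCount {n} G =
  sum (map (λ i → sum (map (λ j →
         if does (i <? j) then (if adj G i j then 1 else 0) else 0)
       (allFin n))) (allFin n))

data Reach {n} (G : Graph n) : Fin n → Fin n → Set where
  here : ∀ {u} → Reach G u u
  step : ∀ {u v w} → Adj G u v → Reach G v w → Reach G u w

IsComponent : ∀ {n} → Graph n → Subset n → Set
IsComponent {n} G S =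
  (∃ λ u → u ∈ S) ×
  (∀ u → u ∈ S → ∀ v → (v ∈ S → Reach G u v) × (Reach G u v → v ∈ S))

IsIndependentIn : ∀ {n} → Graph n → Subset n → Subset n → Set
IsIndependentIn G S I = I ⊆ S × (∀ u v → u ∈ I → v ∈ I → ¬ Adj G u v)

IsIndependenceNumber : ∀ {n} → Graph n → Subset n → ℕ → Set
IsIndependenceNumber G S k =
  (∃ λ I → IsIndependentIn G S I × ∣ I ∣ ≡ k) ×
  (∀ I → IsIndependentIn G S I → ∣ I ∣ ≤ k)

-- Call the number of non-neighbours of u its codegree. Density at least 2/3 means the
-- complement has at most (n choose 2)/3 edges, so the codegrees sum to at most (n² − n)/3
-- and some vertex u has 3·codegree(u) < n. Every vertex outside the component S of u is a
-- non-neighbour of u, so r = n − |S| satisfies 3r < n, i.e. 3|S| > 2n. For an independent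
-- set I ⊆ S of size a, the 2|S|r ordered pairs with exactly one end in S and the a(a − 1)
-- ordered pairs of distinct vertices of I are all non-adjacent, so 3(2|S|r + a² − a) ≤ n² − n;
-- together with 2r < |S| this forces a + 1 + n ≤ 2|S|.

module Submission where

open import Defs
open import Data.Bool using (Bool; true; false; not; if_then_else_)
import Data.Bool.Properties as Bool
open import Data.Empty using (⊥; ⊥-elim)
open import Data.Fin using (Fin; zero; suc; _<?_)
open import Data.Fin.Properties using (_≟_; any?; <⇒≢; <-cmp)
open import Data.Fin.Subset using (Subset; _∈_; _∉_; _⊂_; _⊃_; ∣_∣; ∁; _∪_; ⁅_⁆)
open import Data.Fin.Subset.Induction using (Acc; acc; ⊃-wellFounded)
open import Data.Fin.Subset.Properties
  using (_∈?_; p⊆p∪q; q⊆p∪q; x∈p∪q⁻; x∈⁅x⁆; x∈⁅y⁆⇒x≡y; x∈∁p⇒x∉p; ∣p∣≤n; ∣∁p∣≡n∸∣p∣)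
open import Data.List using (tabulate; map; allFin)
open import Data.List.Properties using (map-tabulate)
import Data.Nat.ListAction as List
open import Data.Nat using (ℕ; zero; suc; _+_; _*_; _≤_; _<_; z≤n; s≤s)
open import Data.Nat.Combinatorics using (_C_; nC1≡n; nCk+nC[k+1]≡[n+1]C[k+1])
open import Data.Nat.Properties hiding (_≟_; _<?_; <-cmp; <⇒≢)
open import Data.Nat.Solver using (module +-*-Solver)
open +-*-Solver using (solve; _:=_; _:+_; _:*_; con)
open import Data.Product using (Σ; ∃; _×_; _,_; proj₁; proj₂)
open import Data.Sum using (inj₁; inj₂)
open import Data.Vec using ([]; _∷_; lookup)
open import Data.Vec.Properties using (lookup-map; []=⇒lookup; lookup⇒[]=)
open import Function using (_∘_)
open import Relation.Nullary using (¬_; Dec; yes; no; does; contradiction)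
open import Relation.Binary.Definitions using (tri<; tri≈; tri>)
open import Relation.Nullary.Decidable using (_×-dec_; ¬?; dec-true; dec-false)
open import Relation.Binary.PropositionalEquality

open import Algebra.Properties.Semiring.Sum +-*-semiring
  using (sum; sum-syntax; sum-replicate-zero; sum-cong-≗; ∑-distrib-+; ∑-comm; *-distribˡ-sum; *-distribʳ-sum)

private
  variable
    n : ℕ

𝟙 : Bool → ℕ
𝟙 b = if b then 1 else 0

𝟙+𝟙-not : ∀ b → 𝟙 b + 𝟙 (not b) ≡ 1
𝟙+𝟙-not true  = refl
𝟙+𝟙-not false = refl

lookup≡false⇒∉ : ∀ {S : Subset n} {i} → lookup S i ≡ false → i ∉ S
lookup≡false⇒∉ eq i∈S with trans (sym eq) ([]=⇒lookup i∈S)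
... | ()

𝟙-lookup-∉ : ∀ {S : Subset n} {i} → i ∉ S → 𝟙 (lookup S i) ≡ 0
𝟙-lookup-∉ {S = S} {i} i∉S with lookup S i in eq
... | true  = ⊥-elim (i∉S (lookup⇒[]= i S eq))
... | false = refl

𝟙-lookup-≤ : ∀ {S : Subset n} {i x} → (i ∈ S → 1 ≤ x) → 𝟙 (lookup S i) ≤ x
𝟙-lookup-≤ {S = S} {i} i∈S⇒1≤x with lookup S i in eq
... | true  = i∈S⇒1≤x (lookup⇒[]= i S eq)
... | false = z≤n

𝟙-lookup²-≤ : ∀ {S T : Subset n} {i j x} → (i ∈ S → j ∈ T → 1 ≤ x) → 𝟙 (lookup S i) * 𝟙 (lookup T j) ≤ x
𝟙-lookup²-≤ {S = S} {T} {i} {j} ∈⇒1≤x with lookup S i in eqᵢ | lookup T j in eqⱼ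
... | true  | true  = ∈⇒1≤x (lookup⇒[]= i S eqᵢ) (lookup⇒[]= j T eqⱼ)
... | true  | false = z≤n
... | false | _     = z≤n

𝟙²≤𝟙 : ∀ b → 𝟙 b * 𝟙 b ≤ 𝟙 b
𝟙²≤𝟙 true  = ≤-refl
𝟙²≤𝟙 false = z≤n

∑-mono-≤ : {f g : Fin n → ℕ} → (∀ i → f i ≤ g i) → sum f ≤ sum g
∑-mono-≤ {zero}  f≤g = z≤n
∑-mono-≤ {suc n} f≤g = +-mono-≤ (f≤g zero) (∑-mono-≤ (f≤g ∘ suc))

∑-const : ∀ n c → ∑[ i < n ] c ≡ n * c
∑-const zero    c = refl
∑-const (suc n) c = cong (c +_) (∑-const n c)

∑-δ : ∀ (i : Fin n) (f : Fin n → ℕ) → ∑[ j < n ] (if does (i ≟ j) then f j else 0) ≡ f i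
∑-δ {suc n} zero    f = trans (cong (f zero +_) (sum-replicate-zero n)) (+-identityʳ _)
∑-δ (suc i) f = ∑-δ i (f ∘ suc)

∑<*⇒∃< : ∀ c (f : Fin n → ℕ) → sum f < n * c → ∃ λ i → f i < c
∑<*⇒∃< {suc n} c f ∑f<n*c with c ≤? f zero
... | no  c≰f₀ = zero , ≰⇒> c≰f₀
... | yes c≤f₀ = let i , fᵢ<c = ∑<*⇒∃< c (f ∘ suc) rest<n*c in suc i , fᵢ<c
  where
  rest<n*c : sum (f ∘ suc) < n * c
  rest<n*c = +-cancelˡ-< c _ _ (≤-<-trans (+-monoˡ-≤ _ c≤f₀) ∑f<n*c)

∑𝟙≡∣∣ : ∀ (S : Subset n) → ∑[ i < n ] 𝟙 (lookup S i) ≡ ∣ S ∣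
∑𝟙≡∣∣ []          = refl
∑𝟙≡∣∣ (true  ∷ S) = cong suc (∑𝟙≡∣∣ S)
∑𝟙≡∣∣ (false ∷ S) = ∑𝟙≡∣∣ S

∑∑-product : ∀ (f g : Fin n → ℕ) → ∑[ i < n ] ∑[ j < n ] (f i * g j) ≡ sum f * sum g
∑∑-product f g = begin
  ∑[ i < _ ] ∑[ j < _ ] (f i * g j) ≡⟨ sum-cong-≗ (λ i → *-distribˡ-sum (f i) g) ⟨
  ∑[ i < _ ] (f i * sum g)          ≡⟨ *-distribʳ-sum (sum g) f ⟨
  sum f * sum g                     ∎
  where open ≡-Reasoning

∑-distrib-+₃ : ∀ (f g k : Fin n → ℕ) → ∑[ i < n ] (f i + g i + k i) ≡ sum f + sum g + sum k
∑-distrib-+₃ f g k = trans (∑-distrib-+ (λ i → f i + g i) k) (cong (_+ sum k) (∑-distrib-+ f g))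

∑∑-distrib-+ : ∀ (f g : Fin n → Fin n → ℕ) →
               ∑[ i < n ] ∑[ j < n ] (f i j + g i j) ≡ ∑[ i < n ] ∑[ j < n ] f i j + ∑[ i < n ] ∑[ j < n ] g i j
∑∑-distrib-+ f g = trans (sum-cong-≗ λ i → ∑-distrib-+ (f i) (g i))
                         (∑-distrib-+ (λ i → ∑[ j < _ ] f i j) (λ i → ∑[ j < _ ] g i j))

∑∑-mono-≤ : {f g : Fin n → Fin n → ℕ} → (∀ i j → f i j ≤ g i j) →
            ∑[ i < n ] ∑[ j < n ] f i j ≤ ∑[ i < n ] ∑[ j < n ] g i j
∑∑-mono-≤ f≤g = ∑-mono-≤ (λ i → ∑-mono-≤ (f≤g i))

∑∑-𝟙-product : ∀ (S T : Subset n) → ∑[ i < n ] ∑[ j < n ] (𝟙 (lookup S i) * 𝟙 (lookup T j)) ≡ ∣ S ∣ * ∣ T ∣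
∑∑-𝟙-product S T = trans (∑∑-product (𝟙 ∘ lookup S) (𝟙 ∘ lookup T)) (cong₂ _*_ (∑𝟙≡∣∣ S) (∑𝟙≡∣∣ T))

sum-tabulate : ∀ (f : Fin n → ℕ) → List.sum (tabulate f) ≡ sum f
sum-tabulate {zero}  f = refl
sum-tabulate {suc n} f = cong (f zero +_) (sum-tabulate (f ∘ suc))

sum-map-allFin : ∀ (f : Fin n → ℕ) → List.sum (map f (allFin n)) ≡ sum f
sum-map-allFin f = trans (cong List.sum (map-tabulate (λ i → i) f)) (sum-tabulate f)

below : (Fin n → Fin n → ℕ) → Fin n → Fin n → ℕ
below h i j = if does (i <? j) then h i j else 0

module _ {h : Fin n → Fin n → ℕ} (h-sym : ∀ i j → h i j ≡ h j i) where

  symmetric-split : ∀ i j → h i j ≡ below h i j + below h j i + (if does (i ≟ j) then h i j else 0)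
  symmetric-split i j with <-cmp i j
  ... | tri< i<j i≢j _ rewrite dec-true (i <? j) i<j | dec-false (j <? i) (<-asym i<j) | dec-false (i ≟ j) i≢j =
    sym (trans (+-identityʳ _) (+-identityʳ _))
  ... | tri≈ i≮j i≡j j≮i rewrite dec-false (i <? j) i≮j | dec-false (j <? i) j≮i | dec-true (i ≟ j) i≡j = refl
  ... | tri> _ i≢j j<i rewrite dec-false (i <? j) (<-asym j<i) | dec-true (j <? i) j<i | dec-false (i ≟ j) i≢j =
    trans (h-sym i j) (sym (+-identityʳ _))

  ∑∑-symmetric : ∑[ i < n ] ∑[ j < n ] h i j ≡ 2 * (∑[ i < n ] ∑[ j < n ] below h i j) + ∑[ i < n ] h i i
  ∑∑-symmetric = begin
    ∑[ i < n ] ∑[ j < n ] h i j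
      ≡⟨ sum-cong-≗ row ⟩
    ∑[ i < n ] (∑[ j < n ] below h i j + ∑[ j < n ] below h j i + h i i)
      ≡⟨ ∑-distrib-+₃ (λ i → ∑[ j < n ] below h i j) (λ i → ∑[ j < n ] below h j i) (λ i → h i i) ⟩
    B + ∑[ i < n ] ∑[ j < n ] below h j i + ∑[ i < n ] h i i
      ≡⟨ cong (λ x → B + x + Δ) (∑-comm (λ i j → below h j i)) ⟩
    B + B + ∑[ i < n ] h i i
      ≡⟨ cong (λ x → B + x + Δ) (+-identityʳ B) ⟨
    2 * B + ∑[ i < n ] h i i
      ∎
    where
    open ≡-Reasoning
    B = ∑[ i < n ] ∑[ j < n ] below h i j
    Δ = ∑[ i < n ] h i i
    row : ∀ i → ∑[ j < n ] h i j ≡ ∑[ j < n ] below h i j + ∑[ j < n ] below h j i + h i i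
    row i = begin
      ∑[ j < n ] h i j
        ≡⟨ sum-cong-≗ (symmetric-split i) ⟩
      ∑[ j < n ] (below h i j + below h j i + δᵢ j)
        ≡⟨ ∑-distrib-+₃ (below h i) (λ j → below h j i) δᵢ ⟩
      ∑[ j < n ] below h i j + ∑[ j < n ] below h j i + sum δᵢ
        ≡⟨ cong (∑[ j < n ] below h i j + ∑[ j < n ] below h j i +_) (∑-δ i (h i)) ⟩
      ∑[ j < n ] below h i j + ∑[ j < n ] below h j i + h i i
        ∎
      where
      δᵢ : Fin n → ℕ
      δᵢ j = if does (i ≟ j) then h i j else 0

pairs-below-diagonal : ∀ n → ∑[ i < n ] ∑[ j < n ] below (λ _ _ → 1) i j ≡ n C 2
pairs-below-diagonal zero    = refl
pairs-below-diagonal (suc n) = begin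
  ∑[ j < n ] 1 + ∑[ i < n ] ∑[ j < n ] below (λ _ _ → 1) i j ≡⟨ cong₂ _+_ (trans (∑-const n 1) (*-identityʳ n)) (pairs-below-diagonal n) ⟩
  n + n C 2                                                 ≡⟨ cong (_+ n C 2) (nC1≡n n) ⟨
  n C 1 + n C 2                                             ≡⟨ nCk+nC[k+1]≡[n+1]C[k+1] n 1 ⟩
  suc n C 2                                                 ∎
  where open ≡-Reasoning

2*[nC2]+n≡n*n : ∀ n → 2 * (n C 2) + n ≡ n * n
2*[nC2]+n≡n*n zero    = refl
2*[nC2]+n≡n*n (suc n) = begin
  2 * (suc n C 2) + suc n     ≡⟨ cong (λ c → 2 * c + suc n) (nCk+nC[k+1]≡[n+1]C[k+1] n 1) ⟨
  2 * (n C 1 + n C 2) + suc n ≡⟨ cong (λ c → 2 * (c + n C 2) + suc n) (nC1≡n n) ⟩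
  2 * (n + n C 2) + suc n     ≡⟨ solve 2 (λ n c → con 2 :* (n :+ c) :+ (con 1 :+ n) := (con 2 :* c :+ n) :+ (con 1 :+ con 2 :* n)) refl n (n C 2) ⟩
  (2 * (n C 2) + n) + (1 + 2 * n) ≡⟨ cong (_+ (1 + 2 * n)) (2*[nC2]+n≡n*n n) ⟩
  n * n + (1 + 2 * n)         ≡⟨ solve 1 (λ n → n :* n :+ (con 1 :+ con 2 :* n) := (con 1 :+ n) :* (con 1 :+ n)) refl n ⟩
  suc n * suc n               ∎
  where open ≡-Reasoning

3*r<n⇒2*n<3*s : ∀ {n} s r → n ≡ s + r → 3 * r < n → 2 * n < 3 * s
3*r<n⇒2*n<3*s s r refl 3r<n = +-cancelʳ-≤ r _ _ (begin
  suc (2 * (s + r)) + r ≡⟨ solve 2 (λ s r → con 1 :+ con 2 :* (s :+ r) :+ r := con 2 :* s :+ (con 1 :+ con 3 :* r)) refl s r ⟩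
  2 * s + suc (3 * r)   ≤⟨ +-monoʳ-≤ (2 * s) 3r<n ⟩
  2 * s + (s + r)       ≡⟨ solve 2 (λ s r → con 2 :* s :+ (s :+ r) := con 3 :* s :+ r) refl s r ⟩
  3 * s + r             ∎)
  where open ≤-Reasoning

-- With s = 2r+1+p and a = r+1+p+q, the excess 3(2sr + a²) + m − (m² + 3a) is 2(m − 1)
-- plus a polynomial with nonnegative coefficients, hence positive when m ≥ 2.
large-independent-excess-impossible : ∀ {s a} r p q D → 2 * r + 1 + p ≡ s → r + 1 + p + q ≡ a → 2 ≤ s + r →
  3 * D + (s + r) ≤ (s + r) * (s + r) → s * r + r * s + a * a ≤ D + a → ⊥
large-independent-excess-impossible r p q D refl refl 2≤m sparse pairs =
  contradiction (+-cancelˡ-≤ (m * m + 3 * a) 4 2 chain) λ { (s≤s (s≤s ())) }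
  where
  s = 2 * r + 1 + p
  a = r + 1 + p + q
  m = s + r
  rest = 6 * r * r + 6 * r * p + 2 * p * p + 3 * q * q + 6 * r * q + 3 * q + 6 * p * q
  expand : 3 * (s * r + r * s + a * a) + m + 2 ≡ m * m + 3 * a + (2 * m + rest)
  expand = solve 3 (λ r p q →
    let s = con 2 :* r :+ con 1 :+ p ; a = r :+ con 1 :+ p :+ q ; m = s :+ r in
    con 3 :* (s :* r :+ r :* s :+ a :* a) :+ m :+ con 2 :=
    m :* m :+ con 3 :* a :+ (con 2 :* m :+
      (con 6 :* r :* r :+ con 6 :* r :* p :+ con 2 :* p :* p :+ con 3 :* q :* q :+ con 6 :* r :* q :+ con 3 :* q :+ con 6 :* p :* q)))
    refl r p q
  chain : m * m + 3 * a + 4 ≤ m * m + 3 * a + 2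
  chain = begin
    m * m + 3 * a + 2 * 2               ≤⟨ +-monoʳ-≤ (m * m + 3 * a) (≤-trans (*-monoʳ-≤ 2 2≤m) (m≤m+n _ rest)) ⟩
    m * m + 3 * a + (2 * m + rest)      ≡⟨ expand ⟨
    3 * (s * r + r * s + a * a) + m + 2 ≤⟨ +-monoˡ-≤ 2 (+-monoˡ-≤ m (*-monoʳ-≤ 3 pairs)) ⟩
    3 * (D + a) + m + 2                 ≡⟨ solve 3 (λ D a m → con 3 :* (D :+ a) :+ m :+ con 2 := con 3 :* D :+ m :+ con 3 :* a :+ con 2) refl D a m ⟩
    3 * D + m + 3 * a + 2               ≤⟨ +-monoˡ-≤ 2 (+-monoˡ-≤ (3 * a) sparse) ⟩
    m * m + 3 * a + 2                   ∎
    where open ≤-Reasoning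

large-independent-set-impossible : ∀ s r a D → 3 * r < s + r → 2 * s < a + 1 + (s + r) → 2 ≤ s + r →
  3 * D + (s + r) ≤ (s + r) * (s + r) → s * r + r * s + a * a ≤ D + a → ⊥
large-independent-set-impossible s r a D 3r<s+r 2s<a+1+s+r =
  let p , 2r+1+p≡s = m≤n⇒∃[o]m+o≡n 2r+1≤s
      q , r+1+p+q≡a = m≤n⇒∃[o]m+o≡n (r+1+p≤a p 2r+1+p≡s)
  in  large-independent-excess-impossible r p q D 2r+1+p≡s r+1+p+q≡a
  where
  2r+1≤s : 2 * r + 1 ≤ s
  2r+1≤s = +-cancelʳ-≤ r _ _ (subst (_≤ s + r) (solve 1 (λ r → con 1 :+ con 3 :* r := con 2 :* r :+ con 1 :+ r) refl r) 3r<s+r)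
  s≤a+r : s ≤ a + r
  s≤a+r = +-cancelˡ-≤ (suc s) _ _ (subst₂ _≤_ (solve 1 (λ s → con 1 :+ con 2 :* s := con 1 :+ s :+ s) refl s)
                                              (solve 3 (λ s r a → a :+ con 1 :+ (s :+ r) := con 1 :+ s :+ (a :+ r)) refl s r a)
                                              2s<a+1+s+r)
  r+1+p≤a : ∀ p → 2 * r + 1 + p ≡ s → r + 1 + p ≤ a
  r+1+p≤a p 2r+1+p≡s = +-cancelʳ-≤ r _ _ (subst (_≤ a + r) shift s≤a+r)
    where
    shift : s ≡ r + 1 + p + r
    shift = trans (sym 2r+1+p≡s) (solve 2 (λ r p → con 2 :* r :+ con 1 :+ p := r :+ con 1 :+ p :+ r) refl r p)

independence-bound : ∀ {n} s r a D → n ≡ s + r → 2 ≤ n → 3 * r < n →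
  3 * D + n ≤ n * n → s * r + r * s + a * a ≤ D + a → a + 1 + n ≤ 2 * s
independence-bound s r a D refl 2≤n 3r<n sparse pairs with a + 1 + (s + r) ≤? 2 * s
... | yes bound = bound
... | no  ¬bound = ⊥-elim (large-independent-set-impossible s r a D 3r<n (≰⇒> ¬bound) 2≤n sparse pairs)

module _ (G : Graph n) where

  Adj-sym : ∀ {u v} → Adj G u v → Adj G v u
  Adj-sym {u} {v} e = trans (adj-sym G v u) e

  Reach-trans : ∀ {u v w} → Reach G u v → Reach G v w → Reach G u w
  Reach-trans here       r′ = r′
  Reach-trans (step e r) r′ = step e (Reach-trans r r′)

  Reach-sym : ∀ {u v} → Reach G u v → Reach G v u
  Reach-sym here       = here
  Reach-sym (step e r) = Reach-trans (Reach-sym r) (step (Adj-sym e) here)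

  Closed : Subset n → Set
  Closed S = ∀ {u v} → u ∈ S → Adj G u v → v ∈ S

  Reach-closed : ∀ {S u v} → Closed S → u ∈ S → Reach G u v → v ∈ S
  Reach-closed S-closed u∈S here       = u∈S
  Reach-closed S-closed u∈S (step e r) = Reach-closed S-closed (S-closed u∈S e) r

  component-closed : ∀ {S} → IsComponent G S → Closed S
  component-closed (_ , reach⇔∈) {u} {v} u∈S e = proj₂ (reach⇔∈ u u∈S v) (step e here)

  ReachedFrom : Fin n → Subset n → Set
  ReachedFrom u S = u ∈ S × (∀ {v} → v ∈ S → Reach G u v)

  closed-reached⇒component : ∀ {S u} → ReachedFrom u S → Closed S → IsComponent G S
  closed-reached⇒component {u = u} (u∈S , reach) S-closed =
    (u , u∈S) , λ v v∈S w → (λ w∈S → Reach-trans (Reach-sym (reach v∈S)) (reach w∈S)) , Reach-closed S-closed v∈S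

  LeavingEdge : Subset n → Set
  LeavingEdge S = ∃ λ v → ∃ λ w → v ∈ S × w ∉ S × Adj G v w

  leavingEdge? : ∀ S → Dec (LeavingEdge S)
  leavingEdge? S = any? λ v → any? λ w → (v ∈? S) ×-dec (¬? (w ∈? S)) ×-dec (adj G v w Bool.≟ true)

  ¬LeavingEdge⇒Closed : ∀ {S} → ¬ LeavingEdge S → Closed S
  ¬LeavingEdge⇒Closed {S} ¬leaving {v} {w} v∈S e with w ∈? S
  ... | yes w∈S = w∈S
  ... | no  w∉S = ⊥-elim (¬leaving (v , w , v∈S , w∉S , e))

  reachable-closure : ∀ u → ∃ λ S → ReachedFrom u S × Closed S
  reachable-closure u = grow ⁅ u ⁆ (⊃-wellFounded ⁅ u ⁆) (x∈⁅x⁆ u , reach-⁅u⁆)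
    where
    reach-⁅u⁆ : ∀ {v} → v ∈ ⁅ u ⁆ → Reach G u v
    reach-⁅u⁆ v∈⁅u⁆ rewrite x∈⁅y⁆⇒x≡y u v∈⁅u⁆ = here

    grow : ∀ S → Acc _⊃_ S → ReachedFrom u S → ∃ λ S → ReachedFrom u S × Closed S
    grow S (acc larger) (u∈S , reach) with leavingEdge? S
    ... | no  ¬leaving                 = S , (u∈S , reach) , ¬LeavingEdge⇒Closed ¬leaving
    ... | yes (v , w , v∈S , w∉S , e) = grow (S ∪ ⁅ w ⁆) (larger S⊂S∪⁅w⁆) (p⊆p∪q ⁅ w ⁆ u∈S , reach′)
      where
      S⊂S∪⁅w⁆ : S ⊂ S ∪ ⁅ w ⁆
      S⊂S∪⁅w⁆ = p⊆p∪q ⁅ w ⁆ , w , q⊆p∪q S ⁅ w ⁆ (x∈⁅x⁆ w) , w∉S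

      reach′ : ∀ {x} → x ∈ S ∪ ⁅ w ⁆ → Reach G u x
      reach′ x∈S∪⁅w⁆ with x∈p∪q⁻ S ⁅ w ⁆ x∈S∪⁅w⁆
      ... | inj₁ x∈S   = reach x∈S
      ... | inj₂ x∈⁅w⁆ rewrite x∈⁅y⁆⇒x≡y w x∈⁅w⁆ = Reach-trans (reach v∈S) (step e here)

  component-of : ∀ u → ∃ λ S → IsComponent G S × u ∈ S
  component-of u =
    let S , reached , S-closed = reachable-closure u
    in  S , closed-reached⇒component reached S-closed , proj₁ reached

module _ (G : Graph n) where

  nonAdj : Fin n → Fin n → ℕ
  nonAdj i j = if does (i ≟ j) then 0 else 𝟙 (not (adj G i j))

  nonAdj-sym : ∀ i j → nonAdj i j ≡ nonAdj j i
  nonAdj-sym i j with i ≟ j | j ≟ i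
  ... | yes _   | yes _   = refl
  ... | yes i≡j | no  j≢i = ⊥-elim (j≢i (sym i≡j))
  ... | no  i≢j | yes j≡i = ⊥-elim (i≢j (sym j≡i))
  ... | no  _   | no  _   = cong (𝟙 ∘ not) (adj-sym G i j)

  nonAdj-irrefl : ∀ i → nonAdj i i ≡ 0
  nonAdj-irrefl i rewrite dec-true (i ≟ i) refl = refl

  𝟙-not-adj : ∀ {i j} → ¬ Adj G i j → 𝟙 (not (adj G i j)) ≡ 1
  𝟙-not-adj {i} {j} ¬adj with adj G i j
  ... | true  = ⊥-elim (¬adj refl)
  ... | false = refl

  nonAdj≡1 : ∀ {i j} → i ≢ j → ¬ Adj G i j → nonAdj i j ≡ 1
  nonAdj≡1 {i} {j} i≢j ¬adj rewrite dec-false (i ≟ j) i≢j = 𝟙-not-adj ¬adj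

  nonAdj-leaving : ∀ {S i j} → Closed G S → i ∈ S → j ∉ S → nonAdj i j ≡ 1
  nonAdj-leaving S-closed i∈S j∉S = nonAdj≡1 (λ { refl → j∉S i∈S }) (j∉S ∘ S-closed i∈S)

  codegree : Fin n → ℕ
  codegree u = ∑[ v < n ] nonAdj u v

  codegreeSum : ℕ
  codegreeSum = ∑[ i < n ] ∑[ j < n ] nonAdj i j

  adjacency : Fin n → Fin n → ℕ
  adjacency i j = 𝟙 (adj G i j)

  edgeCount≡∑∑ : edgeCount G ≡ ∑[ i < n ] ∑[ j < n ] below adjacency i j
  edgeCount≡∑∑ = trans (sum-map-allFin (λ i → List.sum (map (below adjacency i) (allFin n))))
                       (sum-cong-≗ λ i → sum-map-allFin (below adjacency i))

  adjacency+nonAdj-below : ∀ i j → below adjacency i j + below nonAdj i j ≡ below (λ _ _ → 1) i j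
  adjacency+nonAdj-below i j with i <? j
  ... | no  i≮j rewrite dec-false (i <? j) i≮j = refl
  ... | yes i<j rewrite dec-true (i <? j) i<j | dec-false (i ≟ j) (<⇒≢ i<j) = 𝟙+𝟙-not (adj G i j)

  complementEdges : ℕ
  complementEdges = ∑[ i < n ] ∑[ j < n ] below nonAdj i j

  edges+complementEdges≡nC2 : edgeCount G + complementEdges ≡ n C 2
  edges+complementEdges≡nC2 = begin
    edgeCount G + complementEdges
      ≡⟨ cong (_+ complementEdges) edgeCount≡∑∑ ⟩
    ∑[ i < n ] ∑[ j < n ] below adjacency i j + complementEdges
      ≡⟨ ∑∑-distrib-+ (below adjacency) (below nonAdj) ⟨
    ∑[ i < n ] ∑[ j < n ] (below adjacency i j + below nonAdj i j)
      ≡⟨ sum-cong-≗ (λ i → sum-cong-≗ (adjacency+nonAdj-below i)) ⟩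
    ∑[ i < n ] ∑[ j < n ] below (λ _ _ → 1) i j
      ≡⟨ pairs-below-diagonal n ⟩
    n C 2
      ∎
    where open ≡-Reasoning

  codegreeSum≡2*complementEdges : codegreeSum ≡ 2 * complementEdges
  codegreeSum≡2*complementEdges = begin
    codegreeSum                        ≡⟨ ∑∑-symmetric nonAdj-sym ⟩
    2 * complementEdges + ∑[ i < n ] nonAdj i i ≡⟨ cong (2 * complementEdges +_) (trans (sum-cong-≗ nonAdj-irrefl) (sum-replicate-zero n)) ⟩
    2 * complementEdges + 0                ≡⟨ +-identityʳ _ ⟩
    2 * complementEdges                    ∎
    where open ≡-Reasoning

  dense⇒sparse-complement : 2 * (n C 2) ≤ 3 * edgeCount G → 3 * codegreeSum + n ≤ n * n
  dense⇒sparse-complement dense = begin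
    3 * codegreeSum + n         ≡⟨ cong (λ x → 3 * x + n) codegreeSum≡2*complementEdges ⟩
    3 * (2 * complementEdges) + n   ≡⟨ cong (_+ n) (solve 1 (λ x → con 3 :* (con 2 :* x) := con 2 :* (con 3 :* x)) refl complementEdges) ⟩
    2 * (3 * complementEdges) + n   ≤⟨ +-monoˡ-≤ n (*-monoʳ-≤ 2 3*complementEdges≤nC2) ⟩
    2 * (n C 2) + n             ≡⟨ 2*[nC2]+n≡n*n n ⟩
    n * n                       ∎
    where
    open ≤-Reasoning
    3*complementEdges≤nC2 : 3 * complementEdges ≤ n C 2
    3*complementEdges≤nC2 = +-cancelˡ-≤ (2 * (n C 2)) _ _ (begin
      2 * (n C 2) + 3 * complementEdges     ≤⟨ +-monoˡ-≤ (3 * complementEdges) dense ⟩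
      3 * edgeCount G + 3 * complementEdges ≡⟨ *-distribˡ-+ 3 (edgeCount G) complementEdges ⟨
      3 * (edgeCount G + complementEdges)   ≡⟨ cong (3 *_) edges+complementEdges≡nC2 ⟩
      3 * (n C 2)                       ≡⟨ solve 1 (λ c → con 3 :* c := con 2 :* c :+ c) refl (n C 2) ⟩
      2 * (n C 2) + n C 2               ∎)

  low-codegree-vertex : 1 ≤ n → 3 * codegreeSum + n ≤ n * n → ∃ λ u → 3 * codegree u < n
  low-codegree-vertex 1≤n sparse = ∑<*⇒∃< n (λ u → 3 * codegree u) (begin-strict
    ∑[ u < n ] (3 * codegree u) ≡⟨ *-distribˡ-sum 3 codegree ⟨
    3 * codegreeSum           <⟨ m<m+n (3 * codegreeSum) 1≤n ⟩
    3 * codegreeSum + n       ≤⟨ sparse ⟩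
    n * n                     ∎)
    where open ≤-Reasoning

  ∣∁∣≤codegree : ∀ {S u} → Closed G S → u ∈ S → ∣ ∁ S ∣ ≤ codegree u
  ∣∁∣≤codegree {S} {u} S-closed u∈S = begin
    ∣ ∁ S ∣                         ≡⟨ ∑𝟙≡∣∣ (∁ S) ⟨
    ∑[ v < n ] 𝟙 (lookup (∁ S) v) ≤⟨ ∑-mono-≤ (λ v → 𝟙-lookup-≤ (outside≤ v)) ⟩
    codegree u                      ∎
    where
    open ≤-Reasoning
    outside≤ : ∀ v → v ∈ ∁ S → 1 ≤ nonAdj u v
    outside≤ v v∈∁S = ≤-reflexive (sym (nonAdj-leaving S-closed u∈S (x∈∁p⇒x∉p v∈∁S)))

  independent-pair-≤ : ∀ {S I} → IsIndependentIn G S I → ∀ i j →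
    𝟙 (lookup I i) * 𝟙 (lookup I j) ≤ nonAdj i j + (if does (i ≟ j) then 𝟙 (lookup I j) else 0)
  independent-pair-≤ {I = I} (_ , independent) i j with i ≟ j
  ... | yes refl = 𝟙²≤𝟙 (lookup I i)
  ... | no  _    = 𝟙-lookup²-≤ λ i∈I j∈I → ≤-reflexive (cong (_+ 0) (sym (𝟙-not-adj (independent i j i∈I j∈I))))

  -- Pairs with exactly one end in S and pairs of distinct vertices of I ⊆ S are disjoint
  -- sets of non-adjacent pairs; the diagonal of I × I is paid for by the second summand.
  cut-pair-≤ : ∀ {S I} → Closed G S → IsIndependentIn G S I → ∀ i j →
    𝟙 (lookup S i) * 𝟙 (lookup (∁ S) j) + 𝟙 (lookup (∁ S) i) * 𝟙 (lookup S j) + 𝟙 (lookup I i) * 𝟙 (lookup I j)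
      ≤ nonAdj i j + (if does (i ≟ j) then 𝟙 (lookup I j) else 0)
  cut-pair-≤ {S} {I} S-closed I-indep@(I⊆S , _) i j
    rewrite lookup-map i not S | lookup-map j not S
    with lookup S i in eᵢ | lookup S j in eⱼ
  ... | true  | true  = independent-pair-≤ I-indep i j
  ... | true  | false
    rewrite 𝟙-lookup-∉ (lookup≡false⇒∉ eⱼ ∘ I⊆S) | *-zeroʳ (𝟙 (lookup I i))
    = ≤-trans (≤-reflexive (sym (nonAdj-leaving S-closed (lookup⇒[]= i S eᵢ) (lookup≡false⇒∉ eⱼ)))) (m≤m+n _ _)
  ... | false | true
    rewrite 𝟙-lookup-∉ (lookup≡false⇒∉ eᵢ ∘ I⊆S)
    = ≤-trans (≤-reflexive (sym (trans (nonAdj-sym i j) (nonAdj-leaving S-closed (lookup⇒[]= j S eⱼ) (lookup≡false⇒∉ eᵢ))))) (m≤m+n _ _)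
  ... | false | false
    rewrite 𝟙-lookup-∉ (lookup≡false⇒∉ eᵢ ∘ I⊆S) = z≤n

  cut+independent-≤ : ∀ {S I} → Closed G S → IsIndependentIn G S I →
    ∣ S ∣ * ∣ ∁ S ∣ + ∣ ∁ S ∣ * ∣ S ∣ + ∣ I ∣ * ∣ I ∣ ≤ codegreeSum + ∣ I ∣
  cut+independent-≤ {S} {I} S-closed I-indep = begin
    ∣ S ∣ * ∣ ∁ S ∣ + ∣ ∁ S ∣ * ∣ S ∣ + ∣ I ∣ * ∣ I ∣
      ≡⟨ cong₂ _+_ (cong₂ _+_ (∑∑-𝟙-product S (∁ S)) (∑∑-𝟙-product (∁ S) S)) (∑∑-𝟙-product I I) ⟨
    ∑∑ leaving + ∑∑ entering + ∑∑ inside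
      ≡⟨ trans (∑∑-distrib-+ (λ i j → leaving i j + entering i j) inside) (cong (_+ ∑∑ inside) (∑∑-distrib-+ leaving entering)) ⟨
    ∑[ i < n ] ∑[ j < n ] (leaving i j + entering i j + inside i j)
      ≤⟨ ∑∑-mono-≤ (cut-pair-≤ S-closed I-indep) ⟩
    ∑[ i < n ] ∑[ j < n ] (nonAdj i j + δ i j)
      ≡⟨ ∑∑-distrib-+ nonAdj δ ⟩
    codegreeSum + ∑∑ δ
      ≡⟨ cong (codegreeSum +_) (trans (sum-cong-≗ λ i → ∑-δ i (𝟙 ∘ lookup I)) (∑𝟙≡∣∣ I)) ⟩
    codegreeSum + ∣ I ∣
      ∎
    where
    open ≤-Reasoning
    ∑∑ : (Fin n → Fin n → ℕ) → ℕ
    ∑∑ f = ∑[ i < n ] ∑[ j < n ] f i j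
    leaving entering inside δ : Fin n → Fin n → ℕ
    leaving  i j = 𝟙 (lookup S i) * 𝟙 (lookup (∁ S) j)
    entering i j = 𝟙 (lookup (∁ S) i) * 𝟙 (lookup S j)
    inside   i j = 𝟙 (lookup I i) * 𝟙 (lookup I j)
    δ        i j = if does (i ≟ j) then 𝟙 (lookup I j) else 0

module _ {G : Graph n} (2≤n : 2 ≤ n) (sparse : 3 * codegreeSum G + n ≤ n * n)
         {S u} (S-component : IsComponent G S) (u∈S : u ∈ S) (3δ<n : 3 * codegree G u < n) where

  private
    S-closed : Closed G S
    S-closed = component-closed G S-component

    n≡s+r : n ≡ ∣ S ∣ + ∣ ∁ S ∣
    n≡s+r = trans (sym (m+[n∸m]≡n (∣p∣≤n S))) (cong (∣ S ∣ +_) (sym (∣∁p∣≡n∸∣p∣ S)))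

    3r<n : 3 * ∣ ∁ S ∣ < n
    3r<n = ≤-<-trans (*-monoʳ-≤ 3 (∣∁∣≤codegree G S-closed u∈S)) 3δ<n

  low-codegree-component-large : 2 * n < 3 * ∣ S ∣
  low-codegree-component-large = 3*r<n⇒2*n<3*s (∣ S ∣) (∣ ∁ S ∣) n≡s+r 3r<n

  low-codegree-component-α : ∀ a → IsIndependenceNumber G S a → a + 1 + n ≤ 2 * ∣ S ∣
  low-codegree-component-α _ ((I , I-independent , refl) , _) =
    independence-bound (∣ S ∣) (∣ ∁ S ∣) (∣ I ∣) (codegreeSum G) n≡s+r 2≤n 3r<n sparse
                       (cut+independent-≤ G S-closed I-independent)

lemma2p1 : (n : ℕ) → 2 ≤ n → (G : Graph n) →
           2 * (n C 2) ≤ 3 * edgeCount G →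
           Σ (Subset n) (λ S → IsComponent G S × 2 * n < 3 * ∣ S ∣ ×
             ((a : ℕ) → IsIndependenceNumber G S a → a + 1 + n ≤ 2 * ∣ S ∣))
lemma2p1 n 2≤n G dense =
  let sparse       = dense⇒sparse-complement G dense
      u , 3δ<n     = low-codegree-vertex G (≤-trans (s≤s z≤n) 2≤n) sparse
      S , S-component , u∈S = component-of G u
  in  S , S-component , low-codegree-component-large 2≤n sparse S-component u∈S 3δ<n
                      , low-codegree-component-α 2≤n sparse S-component u∈S 3δ<n
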